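{- Let $G$ and $H$ be finite additive groups. If there exist a Fano Kaleidoscopic Difference Family FKDF$(G)$, a Fano Kaleidoscopic Difference Family FKDF$(H)$, and an $(H,7,1)$ difference matrix, then there exists a Fano Kaleidoscopic Difference Family FKDF$(G\times H)$.
   Context: For a subset $B$ of an additive group $G$, $\Delta B$ is the multiset of differences $x-y$ over ordered pairs of distinct $x,y\in B$. A $(G,k,\lambda)$ difference family is a collection of $k$-subsets of $G$ whose difference lists together cover each nonzero element of $G$ exactly $\lambda$ times. For an ordered 7-tuple $B=(b_0,\dots,b_6)$, its $i$-th line is $\ell_i(B)=\{b_i,b_{i+1},b_{i+3}\}$ (indices mod 7). An FKDF$(G)$ is a $(G,7,7)$ difference family together with an ordering of the points of each block such that for each $j\in\{0,\dots,6\}$ the set of $j$-th lines of all its blocks is a $(G,3,1)$ difference family. An $(H,k,1)$ difference matrix is a $k\times|H|$ matrix with entries in $H$ such that the difference of any two distinct rows contains each element of $H$ exactly once. -}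

module Defs where

open import Level using (0ℓ)
open import Data.Nat using (ℕ; _+_; zero; suc)
open import Data.Nat.DivMod using (_%_; m%n<n)
open import Data.Fin using (Fin; toℕ; fromℕ<)
open import Data.List using (List; []; _∷_; map; _++_; concatMap; length; filter; cartesianProduct; allFin)
open import Data.List.Membership.Propositional using (_∈_)
open import Data.List.Membership.Propositional.Properties using (∈-cartesianProduct⁺)
open import Data.List.Relation.Unary.All using (All)
open import Data.List.Relation.Unary.Unique.Propositional using (Unique)
import Data.List.Relation.Unary.Unique.Propositional.Properties as UniqueP
open import Data.Vec using (Vec; lookup; toList)
open import Data.Product using (_×_; _,_; proj₁; proj₂)
open import Data.Product.Properties using (≡-dec)
open import Relation.Binary.Definitions using (DecidableEquality)
open import Relation.Binary.PropositionalEquality using (_≡_; _≢_; cong₂)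
open import Relation.Nullary using (¬_)

record FinAbGroup : Set₁ where
  infixl 6 _+ᴳ_ _-ᴳ_
  field
    Carrier  : Set
    _+ᴳ_     : Carrier → Carrier → Carrier
    0ᴳ       : Carrier
    negᴳ     : Carrier → Carrier
    +-assoc  : ∀ x y z → (x +ᴳ y) +ᴳ z ≡ x +ᴳ (y +ᴳ z)
    +-comm   : ∀ x y → x +ᴳ y ≡ y +ᴳ x
    +-idʳ    : ∀ x → x +ᴳ 0ᴳ ≡ x
    +-invʳ   : ∀ x → x +ᴳ (negᴳ x) ≡ 0ᴳ
    _≟_      : DecidableEquality Carrier
    elements : List Carrier
    complete : ∀ x → x ∈ elements
    unique   : Unique elements

  _-ᴳ_ : Carrier → Carrier → Carrier
  x -ᴳ y = x +ᴳ (negᴳ y)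

  order : ℕ
  order = length elements

_×ᴳ_ : FinAbGroup → FinAbGroup → FinAbGroup
G ×ᴳ H = record
  { Carrier  = G.Carrier × H.Carrier
  ; _+ᴳ_     = λ p q → (proj₁ p G.+ᴳ proj₁ q , proj₂ p H.+ᴳ proj₂ q)
  ; 0ᴳ       = (G.0ᴳ , H.0ᴳ)
  ; negᴳ     = λ p → (G.negᴳ (proj₁ p) , H.negᴳ (proj₂ p))
  ; +-assoc  = λ x y z → cong₂ _,_ (G.+-assoc _ _ _) (H.+-assoc _ _ _)
  ; +-comm   = λ x y → cong₂ _,_ (G.+-comm _ _) (H.+-comm _ _)
  ; +-idʳ    = λ x → cong₂ _,_ (G.+-idʳ _) (H.+-idʳ _)
  ; +-invʳ   = λ x → cong₂ _,_ (G.+-invʳ _) (H.+-invʳ _)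
  ; _≟_      = ≡-dec G._≟_ H._≟_
  ; elements = cartesianProduct G.elements H.elements
  ; complete = λ p → ∈-cartesianProduct⁺ (G.complete (proj₁ p)) (H.complete (proj₂ p))
  ; unique   = UniqueP.cartesianProduct⁺ G.unique H.unique
  }
  where
    module G = FinAbGroup G
    module H = FinAbGroup H

module _ (G : FinAbGroup) where
  open FinAbGroup G

  mult : Carrier → List Carrier → ℕ
  mult g xs = length (filter (g ≟_) xs)

  -- ΔB: multiset of differences x - y over ordered pairs of distinct
  -- positions of the (duplicate-free) list B.
  Δ : List Carrier → List Carrier
  Δ []       = []
  Δ (x ∷ xs) = map (x -ᴳ_) xs ++ map (_-ᴳ x) xs ++ Δ xs

  IsKSubset : ℕ → List Carrier → Set
  IsKSubset k B = Unique B × length B ≡ k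

  IsDifferenceFamily : ℕ → ℕ → List (List Carrier) → Set
  IsDifferenceFamily k λ' F =
    All (IsKSubset k) F ×
    (∀ g → g ≢ 0ᴳ → mult g (concatMap Δ F) ≡ λ')

  _⊕_ : Fin 7 → ℕ → Fin 7
  i ⊕ k = fromℕ< (m%n<n (toℕ i + k) 7)

  line : Fin 7 → Vec Carrier 7 → List Carrier
  line i B = lookup B i ∷ lookup B (i ⊕ 1) ∷ lookup B (i ⊕ 3) ∷ []

  IsFKDF : List (Vec Carrier 7) → Set
  IsFKDF F =
    IsDifferenceFamily 7 7 (map toList F) ×
    (∀ (j : Fin 7) → IsDifferenceFamily 3 1 (map (line j) F))

  record FKDF : Set where
    field
      blocks : List (Vec Carrier 7)
      isFKDF : IsFKDF blocks

  IsDifferenceMatrix : (k : ℕ) → (Fin k → Fin order → Carrier) → Set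
  IsDifferenceMatrix k M =
    ∀ (r s : Fin k) → r ≢ s → ∀ g →
      mult g (map (λ c → M r c -ᴳ M s c) (allFin order)) ≡ 1

  record DifferenceMatrix (k : ℕ) : Set where
    field
      matrix : Fin k → Fin order → Carrier
      isDM   : IsDifferenceMatrix k matrix

module Submission where

-- The FKDF(G × H) consists of the blocks
--   (b_i , M i c)_i   for every block B = (b_i) of F_G and column c of M,
--   (0   , a_i  )_i   for every block A = (a_i) of F_H.
-- Both the full blocks and each family of j-th lines are obtained from a
-- block by selecting a duplicate-free list of positions, so everything
-- follows from one general lemma about an arbitrary selection:
-- if the G-selections form a (G,m,λ) difference family and the
-- H-selections an (H,m,λ) difference family, then the product
-- selections form a (G × H,m,λ) difference family.  Its proof counts
-- multiplicities as sums of indicators over ordered pairs of distinct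
-- positions: summing over the columns of M, a G-difference d paired with
-- the column-wise H-differences is seen exactly once with every h, while
-- the blocks (0, a_i) contribute the differences (0, h) with multiplicity
-- λ.

open import Defs
open import Function using (_∘_; id)
open import Data.Nat using (ℕ; _+_; _*_)
import Data.Nat.Properties as ℕP
open import Algebra.Properties.CommutativeSemigroup ℕP.+-commutativeSemigroup
  using (interchange)
open import Data.Fin using (Fin)
import Data.Fin.Properties as FinP
open import Data.List using (List; []; _∷_; _++_; map; concatMap; length; allFin)
import Data.List.Properties as ListP
open import Data.List.Relation.Unary.All as All using (All; []; _∷_)
import Data.List.Relation.Unary.All.Properties as AllP
open import Data.List.Relation.Unary.AllPairs using ([]; _∷_)
open import Data.List.Relation.Unary.Unique.Propositional using (Unique)
import Data.List.Relation.Unary.Unique.Propositional.Properties as UniqueP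
import Data.List.Relation.Unary.Unique.DecPropositional as UniqueDec
open import Data.Vec as Vec using (Vec; lookup; tabulate; toList)
import Data.Vec.Properties as VecP
open import Data.Product using (_×_; _,_; proj₁; proj₂; <_,_>)
open import Relation.Binary.PropositionalEquality
open import Relation.Nullary using (Dec; yes; no; does)
open import Relation.Nullary.Decidable using (from-yes)
open import Data.Bool using (true; false)
open import Data.Empty using (⊥-elim)

private
  variable
    A B : Set

∑ : List A → (A → ℕ) → ℕ
∑ []       f = 0
∑ (x ∷ xs) f = f x + ∑ xs f

∑-++ : (xs ys : List A) (f : A → ℕ) → ∑ (xs ++ ys) f ≡ ∑ xs f + ∑ ys f
∑-++ []       ys f = refl
∑-++ (x ∷ xs) ys f =
  trans (cong (f x +_) (∑-++ xs ys f)) (sym (ℕP.+-assoc (f x) _ _))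

∑-map : (g : A → B) (xs : List A) (f : B → ℕ) → ∑ (map g xs) f ≡ ∑ xs (f ∘ g)
∑-map g []       f = refl
∑-map g (x ∷ xs) f = cong (f (g x) +_) (∑-map g xs f)

∑-concatMap : (g : A → List B) (xs : List A) (f : B → ℕ) →
  ∑ (concatMap g xs) f ≡ ∑ xs (λ x → ∑ (g x) f)
∑-concatMap g []       f = refl
∑-concatMap g (x ∷ xs) f =
  trans (∑-++ (g x) (concatMap g xs) f) (cong (∑ (g x) f +_) (∑-concatMap g xs f))

∑-congᴬ : {P : A → Set} {xs : List A} {f g : A → ℕ} →
  All P xs → (∀ x → P x → f x ≡ g x) → ∑ xs f ≡ ∑ xs g
∑-congᴬ []                   e = refl
∑-congᴬ {xs = x ∷ _} (p ∷ ps) e = cong₂ _+_ (e x p) (∑-congᴬ ps e)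

∑-cong : (xs : List A) {f g : A → ℕ} → (∀ x → f x ≡ g x) → ∑ xs f ≡ ∑ xs g
∑-cong []       e = refl
∑-cong (x ∷ xs) e = cong₂ _+_ (e x) (∑-cong xs e)

∑-zero : (xs : List A) → ∑ xs (λ _ → 0) ≡ 0
∑-zero []       = refl
∑-zero (_ ∷ xs) = ∑-zero xs

∑-+ : (xs : List A) (f g : A → ℕ) → ∑ xs (λ x → f x + g x) ≡ ∑ xs f + ∑ xs g
∑-+ []       f g = refl
∑-+ (x ∷ xs) f g =
  trans (cong (f x + g x +_) (∑-+ xs f g)) (interchange (f x) (g x) (∑ xs f) (∑ xs g))

∑-*ˡ : (xs : List A) (k : ℕ) (f : A → ℕ) → ∑ xs (λ x → k * f x) ≡ k * ∑ xs f
∑-*ˡ []       k f = sym (ℕP.*-zeroʳ k)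
∑-*ˡ (x ∷ xs) k f =
  trans (cong (k * f x +_) (∑-*ˡ xs k f)) (sym (ℕP.*-distribˡ-+ k (f x) (∑ xs f)))

∑-swap : (xs : List A) (ys : List B) (F : A → B → ℕ) →
  ∑ ys (λ y → ∑ xs (λ x → F x y)) ≡ ∑ xs (λ x → ∑ ys (F x))
∑-swap []       ys F = ∑-zero ys
∑-swap (x ∷ xs) ys F =
  trans (∑-+ ys (F x) (λ y → ∑ xs (λ x → F x y))) (cong (∑ ys (F x) +_) (∑-swap xs ys F))

orderedPairs : List A → List (A × A)
orderedPairs []       = []
orderedPairs (i ∷ is) = map (i ,_) is ++ map (_, i) is ++ orderedPairs is

orderedPairs-distinct : {is : List A} → Unique is →
  All (λ p → proj₁ p ≢ proj₂ p) (orderedPairs is)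
orderedPairs-distinct []       = []
orderedPairs-distinct (i∉is ∷ u) =
  AllP.++⁺ (AllP.map⁺ i∉is)
    (AllP.++⁺ (AllP.map⁺ (All.map (λ ne e → ne (sym e)) i∉is)) (orderedPairs-distinct u))

select : {n : ℕ} → List (Fin n) → Vec A n → List A
select is v = map (lookup v) is

toList-select : {n : ℕ} (v : Vec A n) → toList v ≡ select (allFin n) v
toList-select v = trans (toList-tabulate v) (sym (ListP.map-tabulate id (lookup v)))
  where
  toList-tabulate : {m : ℕ} (w : Vec A m) → toList w ≡ Data.List.tabulate (lookup w)
  toList-tabulate Vec.[]       = refl
  toList-tabulate (x Vec.∷ w) = cong (x ∷_) (toList-tabulate w)

select-tabulate : {n : ℕ} (is : List (Fin n)) (f : Fin n → A) →
  select is (tabulate f) ≡ map f is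
select-tabulate is f = ListP.map-cong (VecP.lookup∘tabulate f) is

module Counting (G : FinAbGroup) where
  open FinAbGroup G

  ind : Carrier → Carrier → ℕ
  ind g x = mult G g (x ∷ [])

  ind-≡ : ∀ g → ind g g ≡ 1
  ind-≡ g with g ≟ g
  ... | yes _ = refl
  ... | no ne = ⊥-elim (ne refl)

  ind-≢ : ∀ g x → g ≢ x → ind g x ≡ 0
  ind-≢ g x ne with g ≟ x
  ... | yes e = ⊥-elim (ne e)
  ... | no _  = refl

  mult-∷ : ∀ g x xs → mult G g (x ∷ xs) ≡ ind g x + mult G g xs
  mult-∷ g x xs with does (g ≟ x)
  ... | true  = refl
  ... | false = refl

  mult-as-∑ : ∀ g xs → mult G g xs ≡ ∑ xs (ind g)
  mult-as-∑ g []       = refl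
  mult-as-∑ g (x ∷ xs) = trans (mult-∷ g x xs) (cong (ind g x +_) (mult-as-∑ g xs))

  mult-map : (g : Carrier) (f : A → Carrier) (xs : List A) →
    mult G g (map f xs) ≡ ∑ xs (ind g ∘ f)
  mult-map g f xs = trans (mult-as-∑ g (map f xs)) (∑-map f xs (ind g))

  mult-family : (g : Carrier) (s : A → List Carrier) (Vs : List A) →
    mult G g (concatMap (Δ G) (map s Vs)) ≡ ∑ Vs (λ V → mult G g (Δ G (s V)))
  mult-family g s Vs = begin
      mult G g (concatMap (Δ G) (map s Vs))
    ≡⟨ mult-as-∑ g (concatMap (Δ G) (map s Vs)) ⟩
      ∑ (concatMap (Δ G) (map s Vs)) (ind g)
    ≡⟨ ∑-concatMap (Δ G) (map s Vs) (ind g) ⟩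
      ∑ (map s Vs) (λ B → ∑ (Δ G B) (ind g))
    ≡⟨ ∑-map s Vs _ ⟩
      ∑ Vs (λ V → ∑ (Δ G (s V)) (ind g))
    ≡⟨ ∑-cong Vs (λ V → sym (mult-as-∑ g (Δ G (s V)))) ⟩
      ∑ Vs (λ V → mult G g (Δ G (s V)))
    ∎
    where open ≡-Reasoning

  pairDiff : (A → Carrier) → A × A → Carrier
  pairDiff f p = f (proj₁ p) -ᴳ f (proj₂ p)

  Δ-map : {I : Set} (f : I → Carrier) (is : List I) →
    Δ G (map f is) ≡ map (pairDiff f) (orderedPairs is)
  Δ-map f []       = refl
  Δ-map f (i ∷ is) = sym (begin
      map φ (map (i ,_) is ++ map (_, i) is ++ orderedPairs is)
    ≡⟨ ListP.map-++ φ (map (i ,_) is) _ ⟩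
      map φ (map (i ,_) is) ++ map φ (map (_, i) is ++ orderedPairs is)
    ≡⟨ cong (map φ (map (i ,_) is) ++_) (ListP.map-++ φ (map (_, i) is) _) ⟩
      map φ (map (i ,_) is) ++ map φ (map (_, i) is) ++ map φ (orderedPairs is)
    ≡⟨ cong₂ _++_ (sym (ListP.map-∘ is)) (cong₂ _++_ (sym (ListP.map-∘ is)) (sym (Δ-map f is))) ⟩
      map ((f i -ᴳ_) ∘ f) is ++ map ((_-ᴳ f i) ∘ f) is ++ Δ G (map f is)
    ≡⟨ cong₂ _++_ (ListP.map-∘ is) (cong (_++ Δ G (map f is)) (ListP.map-∘ is)) ⟩
      Δ G (map f (i ∷ is))
    ∎)
    where
    open ≡-Reasoning
    φ = pairDiff f

  mult-Δ : (g : Carrier) (f : A → Carrier) (is : List A) →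
    mult G g (Δ G (map f is)) ≡ ∑ (orderedPairs is) (ind g ∘ pairDiff f)
  mult-Δ g f is = trans (cong (mult G g) (Δ-map f is)) (mult-map g (pairDiff f) (orderedPairs is))

  -ᴳ≡0⇒≡ : ∀ a b → a -ᴳ b ≡ 0ᴳ → a ≡ b
  -ᴳ≡0⇒≡ a b e = begin
      a                      ≡⟨ sym (+-idʳ a) ⟩
      a +ᴳ 0ᴳ                ≡⟨ cong (a +ᴳ_) (sym (trans (+-comm (negᴳ b) b) (+-invʳ b))) ⟩
      a +ᴳ (negᴳ b +ᴳ b)     ≡⟨ sym (+-assoc a (negᴳ b) b) ⟩
      (a -ᴳ b) +ᴳ b          ≡⟨ cong (_+ᴳ b) e ⟩
      0ᴳ +ᴳ b                ≡⟨ +-comm 0ᴳ b ⟩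
      b +ᴳ 0ᴳ                ≡⟨ +-idʳ b ⟩
      b                      ∎
    where open ≡-Reasoning

  Δ-zero-free : ∀ xs → Unique xs → mult G 0ᴳ (Δ G xs) ≡ 0
  Δ-zero-free xs u = begin
      mult G 0ᴳ (Δ G xs)                       ≡⟨ cong (mult G 0ᴳ ∘ Δ G) (sym (ListP.map-id xs)) ⟩
      mult G 0ᴳ (Δ G (map id xs))              ≡⟨ mult-Δ 0ᴳ id xs ⟩
      ∑ (orderedPairs xs) (ind 0ᴳ ∘ pairDiff id) ≡⟨ ∑-congᴬ (orderedPairs-distinct u) nonzero ⟩
      ∑ (orderedPairs xs) (λ _ → 0)             ≡⟨ ∑-zero (orderedPairs xs) ⟩
      0                                        ∎
    where
    open ≡-Reasoning
    nonzero : ∀ p → proj₁ p ≢ proj₂ p → ind 0ᴳ (pairDiff id p) ≡ 0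
    nonzero p ne = ind-≢ 0ᴳ (pairDiff id p) (λ e → ne (-ᴳ≡0⇒≡ _ _ (sym e)))

  family-zero-free : ∀ {k} (F : List (List Carrier)) → All (IsKSubset G k) F →
    mult G 0ᴳ (concatMap (Δ G) F) ≡ 0
  family-zero-free F kF = begin
      mult G 0ᴳ (concatMap (Δ G) F)        ≡⟨ cong (mult G 0ᴳ ∘ concatMap (Δ G)) (sym (ListP.map-id F)) ⟩
      mult G 0ᴳ (concatMap (Δ G) (map id F)) ≡⟨ mult-family 0ᴳ id F ⟩
      ∑ F (λ B → mult G 0ᴳ (Δ G B))         ≡⟨ ∑-congᴬ kF (λ B kB → Δ-zero-free B (proj₁ kB)) ⟩
      ∑ F (λ _ → 0)                         ≡⟨ ∑-zero F ⟩
      0                                     ∎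
    where open ≡-Reasoning

module _ {I : Set} (x : I → A) (y : I → B) (is : List I) where

  paired-unique₁ : Unique (map x is) → Unique (map < x , y > is)
  paired-unique₁ u = UniqueP.map⁻ {f = proj₁} (subst Unique (ListP.map-∘ is) u)

  paired-unique₂ : Unique (map y is) → Unique (map < x , y > is)
  paired-unique₂ u = UniqueP.map⁻ {f = proj₂} (subst Unique (ListP.map-∘ is) u)

module Product (G H : FinAbGroup) where
  private
    module G = FinAbGroup G
    module H = FinAbGroup H
  module CG  = Counting G
  module CH  = Counting H
  module CGH = Counting (G ×ᴳ H)

  ind-× : ∀ g h a b → CGH.ind (g , h) (a , b) ≡ CG.ind g a * CH.ind h b
  ind-× g h a b = byCases (G._≟_ g a) (H._≟_ h b)
    where
    open ≡-Reasoning
    byCases : Dec (g ≡ a) → Dec (h ≡ b) → CGH.ind (g , h) (a , b) ≡ CG.ind g a * CH.ind h b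
    byCases (yes refl) (yes refl) =
      trans (CGH.ind-≡ (g , h)) (sym (cong₂ _*_ (CG.ind-≡ g) (CH.ind-≡ h)))
    byCases (yes refl) (no h≢b) = begin
      CGH.ind (g , h) (g , b)    ≡⟨ CGH.ind-≢ _ _ (h≢b ∘ cong proj₂) ⟩
      0                          ≡⟨ sym (ℕP.*-zeroʳ (CG.ind g g)) ⟩
      CG.ind g g * 0             ≡⟨ cong (CG.ind g g *_) (sym (CH.ind-≢ h b h≢b)) ⟩
      CG.ind g g * CH.ind h b    ∎
    byCases (no g≢a) _ = begin
      CGH.ind (g , h) (a , b)    ≡⟨ CGH.ind-≢ _ _ (g≢a ∘ cong proj₁) ⟩
      0                          ≡⟨ cong (_* CH.ind h b) (sym (CG.ind-≢ g a g≢a)) ⟩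
      CG.ind g a * CH.ind h b    ∎

  mult-Δ-paired : {I : Set} (x : I → G.Carrier) (y : I → H.Carrier) (is : List I) → ∀ g h →
    mult (G ×ᴳ H) (g , h) (Δ (G ×ᴳ H) (map < x , y > is))
      ≡ ∑ (orderedPairs is) (λ p → CG.ind g (CG.pairDiff x p) * CH.ind h (CH.pairDiff y p))
  mult-Δ-paired x y is g h =
    trans (CGH.mult-Δ (g , h) < x , y > is)
      (∑-cong (orderedPairs is) (λ p → ind-× g h (CG.pairDiff x p) (CH.pairDiff y p)))

module ProductConstruction (G H : FinAbGroup) {k : ℕ} (D : DifferenceMatrix H k) where
  open Product G H
  private
    module G = FinAbGroup G
    module H = FinAbGroup H
    GH = G ×ᴳ H
  open DifferenceMatrix D renaming (matrix to M; isDM to M-isDM)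

  columns : List (Fin H.order)
  columns = allFin H.order

  column : Fin H.order → Fin k → H.Carrier
  column c i = M i c

  liftBlock : Vec G.Carrier k → Fin H.order → Vec (G.Carrier × H.Carrier) k
  liftBlock B c = tabulate < lookup B , column c >

  embedBlock : Vec H.Carrier k → Vec (G.Carrier × H.Carrier) k
  embedBlock A = tabulate < (λ _ → G.0ᴳ) , lookup A >

  productBlocks : List (Vec G.Carrier k) → List (Vec H.Carrier k) →
    List (Vec (G.Carrier × H.Carrier) k)
  productBlocks Bs As = concatMap (λ B → map (liftBlock B) columns) Bs ++ map embedBlock As

  column-differences : ∀ r s → r ≢ s → ∀ h →
    ∑ columns (λ c → CH.ind h (CH.pairDiff (column c) (r , s))) ≡ 1
  column-differences r s r≢s h =
    trans (sym (CH.mult-map h (λ c → M r c H.-ᴳ M s c) columns)) (M-isDM r s r≢s h)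

  -- Over all columns, the lifts of B contain (g , h) as often as
  -- Δ(B) contains g: each G-difference meets every h in exactly one column.
  lifted-count : (is : List (Fin k)) → Unique is → (B : Vec G.Carrier k) → ∀ g h →
    ∑ columns (λ c → mult GH (g , h) (Δ GH (select is (liftBlock B c))))
      ≡ mult G g (Δ G (select is B))
  lifted-count is u B g h = begin
      ∑ columns (λ c → mult GH (g , h) (Δ GH (select is (liftBlock B c))))
    ≡⟨ ∑-cong columns (λ c → cong (mult GH (g , h) ∘ Δ GH) (select-tabulate is _)) ⟩
      ∑ columns (λ c → mult GH (g , h) (Δ GH (map < lookup B , column c > is)))
    ≡⟨ ∑-cong columns (λ c → mult-Δ-paired (lookup B) (column c) is g h) ⟩
      ∑ columns (λ c → ∑ ps (λ p → dB p * dM c p))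
    ≡⟨ ∑-swap ps columns (λ p c → dB p * dM c p) ⟩
      ∑ ps (λ p → ∑ columns (λ c → dB p * dM c p))
    ≡⟨ ∑-congᴬ (orderedPairs-distinct u) each-pair ⟩
      ∑ ps dB
    ≡⟨ sym (CG.mult-Δ g (lookup B) is) ⟩
      mult G g (Δ G (select is B))
    ∎
    where
    open ≡-Reasoning
    ps = orderedPairs is
    dB : Fin k × Fin k → ℕ
    dB p = CG.ind g (CG.pairDiff (lookup B) p)
    dM : Fin H.order → Fin k × Fin k → ℕ
    dM c p = CH.ind h (CH.pairDiff (column c) p)
    each-pair : ∀ p → proj₁ p ≢ proj₂ p → ∑ columns (λ c → dB p * dM c p) ≡ dB p
    each-pair p r≢s = begin
      ∑ columns (λ c → dB p * dM c p)  ≡⟨ ∑-*ˡ columns (dB p) (λ c → dM c p) ⟩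
      dB p * ∑ columns (λ c → dM c p)  ≡⟨ cong (dB p *_) (column-differences (proj₁ p) (proj₂ p) r≢s h) ⟩
      dB p * 1                         ≡⟨ ℕP.*-identityʳ (dB p) ⟩
      dB p                             ∎

  embedded-count : (is : List (Fin k)) (A : Vec H.Carrier k) → ∀ g h →
    mult GH (g , h) (Δ GH (select is (embedBlock A)))
      ≡ CG.ind g G.0ᴳ * mult H h (Δ H (select is A))
  embedded-count is A g h = begin
      mult GH (g , h) (Δ GH (select is (embedBlock A)))
    ≡⟨ cong (mult GH (g , h) ∘ Δ GH) (select-tabulate is _) ⟩
      mult GH (g , h) (Δ GH (map < (λ _ → G.0ᴳ) , lookup A > is))
    ≡⟨ mult-Δ-paired (λ _ → G.0ᴳ) (lookup A) is g h ⟩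
      ∑ ps (λ p → CG.ind g (G.0ᴳ G.-ᴳ G.0ᴳ) * dA p)
    ≡⟨ ∑-cong ps (λ p → cong (λ z → CG.ind g z * dA p) (G.+-invʳ G.0ᴳ)) ⟩
      ∑ ps (λ p → CG.ind g G.0ᴳ * dA p)
    ≡⟨ ∑-*ˡ ps (CG.ind g G.0ᴳ) dA ⟩
      CG.ind g G.0ᴳ * ∑ ps dA
    ≡⟨ cong (CG.ind g G.0ᴳ *_) (sym (CH.mult-Δ h (lookup A) is)) ⟩
      CG.ind g G.0ᴳ * mult H h (Δ H (select is A))
    ∎
    where
    open ≡-Reasoning
    ps = orderedPairs is
    dA : Fin k × Fin k → ℕ
    dA p = CH.ind h (CH.pairDiff (lookup A) p)

  family-count : (is : List (Fin k)) → Unique is →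
    (Bs : List (Vec G.Carrier k)) (As : List (Vec H.Carrier k)) → ∀ g h →
    mult GH (g , h) (concatMap (Δ GH) (map (select is) (productBlocks Bs As)))
      ≡ mult G g (concatMap (Δ G) (map (select is) Bs))
        + CG.ind g G.0ᴳ * mult H h (concatMap (Δ H) (map (select is) As))
  family-count is u Bs As g h = begin
      mult GH (g , h) (concatMap (Δ GH) (map (select is) (productBlocks Bs As)))
    ≡⟨ CGH.mult-family (g , h) (select is) (productBlocks Bs As) ⟩
      ∑ (concatMap lifts Bs ++ map embedBlock As) count
    ≡⟨ ∑-++ (concatMap lifts Bs) (map embedBlock As) count ⟩
      ∑ (concatMap lifts Bs) count + ∑ (map embedBlock As) count
    ≡⟨ cong₂ _+_ (∑-concatMap lifts Bs count) (∑-map embedBlock As count) ⟩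
      ∑ Bs (λ B → ∑ (lifts B) count) + ∑ As (count ∘ embedBlock)
    ≡⟨ cong₂ _+_ (∑-cong Bs (λ B → trans (∑-map (liftBlock B) columns count) (lifted-count is u B g h)))
                 (∑-cong As (λ A → embedded-count is A g h)) ⟩
      ∑ Bs (λ B → mult G g (Δ G (select is B)))
        + ∑ As (λ A → CG.ind g G.0ᴳ * mult H h (Δ H (select is A)))
    ≡⟨ cong (∑ Bs (λ B → mult G g (Δ G (select is B))) +_) (∑-*ˡ As (CG.ind g G.0ᴳ) _) ⟩
      ∑ Bs (λ B → mult G g (Δ G (select is B)))
        + CG.ind g G.0ᴳ * ∑ As (λ A → mult H h (Δ H (select is A)))
    ≡⟨ cong₂ (λ x y → x + CG.ind g G.0ᴳ * y)
         (sym (CG.mult-family g (select is) Bs)) (sym (CH.mult-family h (select is) As)) ⟩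
      mult G g (concatMap (Δ G) (map (select is) Bs))
        + CG.ind g G.0ᴳ * mult H h (concatMap (Δ H) (map (select is) As))
    ∎
    where
    open ≡-Reasoning
    lifts : Vec G.Carrier k → List (Vec (G.Carrier × H.Carrier) k)
    lifts B = map (liftBlock B) columns
    count : Vec (G.Carrier × H.Carrier) k → ℕ
    count V = mult GH (g , h) (Δ GH (select is V))

  productBlocks-kSubsets : ∀ {m} (is : List (Fin k))
    (Bs : List (Vec G.Carrier k)) (As : List (Vec H.Carrier k)) →
    All (IsKSubset G m) (map (select is) Bs) → All (IsKSubset H m) (map (select is) As) →
    All (IsKSubset GH m) (map (select is) (productBlocks Bs As))
  productBlocks-kSubsets {m} is Bs As kBs kAs =
    AllP.map⁺ (AllP.++⁺ (AllP.concat⁺ (AllP.map⁺ (All.map (λ {B} → lifts-kSubsets B) (AllP.map⁻ kBs))))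
                        (AllP.map⁺ (All.map (λ {A} → embedded-kSubset A) (AllP.map⁻ kAs))))
    where
    paired-length : {x : Fin k → G.Carrier} {y : Fin k → H.Carrier} {f : Fin k → A} →
      length (map f is) ≡ m → length (map < x , y > is) ≡ m
    paired-length {f = f} len = trans (ListP.length-map _ is) (trans (sym (ListP.length-map f is)) len)

    lifts-kSubsets : ∀ B → IsKSubset G m (select is B) →
      All (IsKSubset GH m ∘ select is) (map (liftBlock B) columns)
    lifts-kSubsets B (u , len) = AllP.map⁺ (All.universal lifted columns)
      where
      lifted : ∀ c → IsKSubset GH m (select is (liftBlock B c))
      lifted c = subst (IsKSubset GH m) (sym (select-tabulate is _))
        (paired-unique₁ (lookup B) (column c) is u , paired-length len)

    embedded-kSubset : ∀ A → IsKSubset H m (select is A) → IsKSubset GH m (select is (embedBlock A))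
    embedded-kSubset A (u , len) = subst (IsKSubset GH m) (sym (select-tabulate is _))
      (paired-unique₂ (λ _ → G.0ᴳ) (lookup A) is u , paired-length len)

  product-differenceFamily : ∀ {m l} (is : List (Fin k)) → Unique is →
    (Bs : List (Vec G.Carrier k)) (As : List (Vec H.Carrier k)) →
    IsDifferenceFamily G m l (map (select is) Bs) →
    IsDifferenceFamily H m l (map (select is) As) →
    IsDifferenceFamily GH m l (map (select is) (productBlocks Bs As))
  product-differenceFamily {m} {l} is u Bs As (kBs , countG) (kAs , countH) =
    productBlocks-kSubsets is Bs As kBs kAs , count
    where
    open ≡-Reasoning
    multG : G.Carrier → ℕ
    multG g = mult G g (concatMap (Δ G) (map (select is) Bs))
    multH : H.Carrier → ℕ
    multH h = mult H h (concatMap (Δ H) (map (select is) As))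
    multGH : G.Carrier × H.Carrier → ℕ
    multGH x = mult GH x (concatMap (Δ GH) (map (select is) (productBlocks Bs As)))

    -- (0 , h) only arises from the embedded H-blocks, (g , h) with g ≢ 0
    -- only from the lifted G-blocks.
    count : ∀ x → x ≢ FinAbGroup.0ᴳ GH → multGH x ≡ l
    count (g , h) g,h≢0 with G._≟_ g G.0ᴳ
    ... | yes refl = begin
      multGH (G.0ᴳ , h)                        ≡⟨ family-count is u Bs As G.0ᴳ h ⟩
      multG G.0ᴳ + CG.ind G.0ᴳ G.0ᴳ * multH h
        ≡⟨ cong₂ (λ x y → x + y * multH h) (CG.family-zero-free _ kBs) (CG.ind-≡ G.0ᴳ) ⟩
      0 + 1 * multH h                          ≡⟨ ℕP.*-identityˡ (multH h) ⟩
      multH h                                  ≡⟨ countH h (g,h≢0 ∘ cong (G.0ᴳ ,_)) ⟩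
      l                                        ∎
    ... | no g≢0 = begin
      multGH (g , h)                           ≡⟨ family-count is u Bs As g h ⟩
      multG g + CG.ind g G.0ᴳ * multH h
        ≡⟨ cong₂ (λ x y → x + y * multH h) (countG g g≢0) (CG.ind-≢ g G.0ᴳ g≢0) ⟩
      l + 0 * multH h                          ≡⟨ ℕP.+-identityʳ l ⟩
      l                                        ∎

-- The offset operation ⊕
-- of Defs is parametrised by a group but does not depend on it, so these
-- lists (and their duplicate-freeness) are the same for every group.
lineIndices : FinAbGroup → Fin 7 → List (Fin 7)
lineIndices G j = j ∷ _⊕_ G j 1 ∷ _⊕_ G j 3 ∷ []

lineIndices-unique : (G : FinAbGroup) → ∀ j → Unique (lineIndices G j)
lineIndices-unique G = from-yes (FinP.all? (λ j → UniqueDec.unique? FinP._≟_ (lineIndices G j)))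

map-toList-select : {n : ℕ} (Vs : List (Vec A n)) → map toList Vs ≡ map (select (allFin n)) Vs
map-toList-select = ListP.map-cong toList-select

-- Both conditions are instances of the main lemma, with
-- all seven positions resp. the positions of the j-th line selected.

theorem8 : (G H : FinAbGroup) →
    FKDF G → FKDF H → DifferenceMatrix H 7 → FKDF (G ×ᴳ H)
theorem8 G H FG FH D = record { blocks = productBlocks Bs As ; isFKDF = points , lines }
  where
  open ProductConstruction G H D
  open FKDF FG renaming (blocks to Bs; isFKDF to Bs-isFKDF)
  open FKDF FH renaming (blocks to As; isFKDF to As-isFKDF)

  points : IsDifferenceFamily (G ×ᴳ H) 7 7 (map toList (productBlocks Bs As))
  points = subst (IsDifferenceFamily (G ×ᴳ H) 7 7) (sym (map-toList-select (productBlocks Bs As)))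
    (product-differenceFamily (allFin 7) (UniqueP.allFin⁺ 7) Bs As
      (subst (IsDifferenceFamily G 7 7) (map-toList-select Bs) (proj₁ Bs-isFKDF))
      (subst (IsDifferenceFamily H 7 7) (map-toList-select As) (proj₁ As-isFKDF)))

  lines : ∀ j → IsDifferenceFamily (G ×ᴳ H) 3 1 (map (line (G ×ᴳ H) j) (productBlocks Bs As))
  lines j = product-differenceFamily (lineIndices G j) (lineIndices-unique G j) Bs As
    (proj₂ Bs-isFKDF j) (proj₂ As-isFKDF j)
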